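{- Let $a,b,c,e\in\mathbb Z$ with $a\neq 0$ and $e>0$, and let $h_3(j)=aj^3+bj^2+cj+e$ for $j\in\mathbb Z_{\geq 0}$, where it is assumed that $h_3(j)\geq 0$ for all $j\geq 0$. Put $\alpha=a/e$, $\beta=b/e$, $\gamma=c/e$ and $f(x)=\frac{1}{2}x^2-(\alpha+\beta+\gamma+\frac{3}{2})x+(9\alpha+5\beta+3\gamma+2)$. Assume $\alpha+\beta+\gamma\geq 2$. If there exists an integer $d$ with $3\leq d\leq c(h_3)+1$ such that $f(d)<0$, then $\operatorname{hdepth}(h_3)<d$.
   Context: $\mathcal H_0$ denotes the set of functions $h:\mathbb Z_{\geq 0}\to\mathbb Z_{\geq 0}$ with $h(0)>0$. For $h\in\mathcal H_0$ and integers $0\leq k\leq d$, set $\beta_k^d(h)=\sum_{j=0}^k(-1)^{k-j}\binom{d-j}{k-j}h(j)$. The Hilbert depth of $h$ is $\operatorname{hdepth}(h)=\max\{d\in\mathbb Z_{\geq 0}\;:\;\beta_k^d(h)\geq 0\text{ for all }0\leq k\leq d\}$. Also $c(h):=\lfloor h(1)/h(0)\rfloor$. -}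

module Defs where

open import Data.Nat as ℕ using (ℕ; zero; suc; _∸_; NonZero)
import Data.Nat.DivMod as ℕD
open import Data.Nat.Combinatorics using (_C_)
open import Data.Integer as ℤ using (ℤ; +_; -1ℤ; 0ℤ)
open import Data.List using (List; map; foldr; upTo)
open import Data.Product using (_×_)
import Data.Rational as ℚ
open ℚ using (ℚ; ½)

sumℤ : (k : ℕ) → (ℕ → ℤ) → ℤ
sumℤ k g = foldr ℤ._+_ 0ℤ (map g (upTo (suc k)))

betaH : (h : ℕ → ℕ) (d k : ℕ) → ℤ
betaH h d k = sumℤ k (λ j → (-1ℤ ℤ.^ (k ∸ j)) ℤ.* (+ ((d ∸ j) C (k ∸ j))) ℤ.* (+ h j))

DepthOK : (h : ℕ → ℕ) (d : ℕ) → Set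
DepthOK h d = ∀ k → k ℕ.≤ d → 0ℤ ℤ.≤ betaH h d k

IsHDepth : (h : ℕ → ℕ) (n : ℕ) → Set
IsHDepth h n = DepthOK h n × (∀ m → DepthOK h m → m ℕ.≤ n)

-- floor division; the zero-divisor case never occurs for h ∈ H_0
floorDiv : ℕ → ℕ → ℕ
floorDiv m zero = 0
floorDiv m (suc n) = m ℕD./ suc n

cH : (h : ℕ → ℕ) → ℕ
cH h = floorDiv (h 1) (h 0)

fPoly : (a b c : ℤ) (e : ℕ) .{{_ : NonZero e}} → ℚ → ℚ
fPoly a b c e x =
  ½ ℚ.* x ℚ.* x
  ℚ.- (α ℚ.+ β ℚ.+ γ ℚ.+ (+ 3 ℚ./ 2)) ℚ.* x
  ℚ.+ ((+ 9 ℚ./ 1) ℚ.* α ℚ.+ (+ 5 ℚ./ 1) ℚ.* β ℚ.+ (+ 3 ℚ./ 1) ℚ.* γ ℚ.+ (+ 2 ℚ./ 1))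
  where
  α β γ : ℚ
  α = a ℚ./ e
  β = b ℚ./ e
  γ = c ℚ./ e

{-# OPTIONS --safe #-}
module Submission where

-- Pascal's rule gives β_{k+1}^d = β_{k+1}^{d+1} + β_k^d for k ≤ d, so if β_k^{d'} ≥ 0 for all
-- k ≤ d', the same holds for d' − 1; hence hdepth(h) ≥ d forces β_2^d(h) ≥ 0.  For the cubic h₃,
-- β_2^d = C(d,2) h₃(0) − (d − 1) h₃(1) + h₃(2) equals e·f(d), so f(d) < 0 rules this out.

open import Defs
open import Data.Nat as ℕ using (ℕ; NonZero)
open import Data.Integer as ℤ using (ℤ; +_; 0ℤ)
import Data.Rational as ℚ
open import Relation.Binary.PropositionalEquality using (_≡_; _≢_)

open import Level using (0ℓ)
open import Function using (_∘_; id)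
open import Data.Nat using (suc; zero; _∸_; s≤s; z≤n; _≤′_; ≤′-reflexive; ≤′-step)
import Data.Nat.Properties as ℕP
open import Data.Nat.Combinatorics using (_C_; nC1≡n; nCk+nC[k+1]≡[n+1]C[k+1])
open import Data.Integer using (_+_; _*_; _-_; -_; _^_; _≤_; +≤+; -1ℤ; 1ℤ)
import Data.Integer.Properties as ℤP
open import Data.Integer.Tactic.RingSolver using (solve-∀)
open import Data.List using (foldr; _∷_; [])
open import Data.List.Properties using (map-applyUpTo)
open import Data.Product using (_,_)
open import Data.Rational using (ℚ; ½)
import Data.Rational.Properties as ℚP
import Data.Rational.Unnormalised as ℚᵘ
open ℚᵘ using (mkℚᵘ; *≡*)
import Data.Rational.Unnormalised.Properties as ℚᵘP
open import Relation.Binary.PropositionalEquality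
  using (refl; sym; trans; cong; cong₂; subst; module ≡-Reasoning)
open import Relation.Nullary.Decidable using (dec⇒maybe)
import Tactic.RingSolver as RingSolver
import Tactic.RingSolver.Core.AlmostCommutativeRing as ACR

betaSummand : (ℕ → ℕ) → ℕ → ℕ → ℕ → ℤ
betaSummand h d k j = (-1ℤ ^ (k ∸ j)) * (+ ((d ∸ j) C (k ∸ j))) * (+ h j)

sumℤ-suc : ∀ k g → sumℤ (suc k) g ≡ g 0 + sumℤ k (g ∘ suc)
sumℤ-suc k g = cong (λ xs → g 0 + foldr _+_ 0ℤ xs)
  (trans (map-applyUpTo suc g (suc k)) (sym (map-applyUpTo id (g ∘ suc) (suc k))))

betaH-suc : ∀ h d k → betaH h (suc d) (suc k) ≡
  -1ℤ ^ suc k * + (suc d C suc k) * + h 0 + betaH (h ∘ suc) d k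
betaH-suc h d k = sumℤ-suc k (betaSummand h (suc d) (suc k))

betaH-zero : ∀ h d → betaH h d 0 ≡ + h 0
betaH-zero h d = ring (+ h 0)
  where
  ring : ∀ x → 1ℤ * + 1 * x + 0ℤ ≡ x
  ring = solve-∀

betaH-one : ∀ h d → betaH h d 1 ≡ + h 1 - + d * + h 0
betaH-one h d = trans (cong (λ n → -1ℤ * + n * + h 0 + (1ℤ * + 1 * + h 1 + 0ℤ)) (nC1≡n d))
                      (ring (+ d) (+ h 0) (+ h 1))
  where
  ring : ∀ n x y → -1ℤ * n * x + (1ℤ * + 1 * y + 0ℤ) ≡ y - n * x
  ring = solve-∀

betaH-pascal : ∀ h {d k} → k ℕ.≤ d → betaH h d (suc k) ≡ betaH h (suc d) (suc k) + betaH h d k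
betaH-pascal h {d} {zero} _ = begin
  betaH h d 1                                ≡⟨ betaH-one h d ⟩
  + h 1 - + d * + h 0                        ≡⟨ ring (+ d) (+ h 0) (+ h 1) ⟩
  (+ h 1 - + suc d * + h 0) + + h 0          ≡⟨ sym (cong₂ _+_ (betaH-one h (suc d)) (betaH-zero h d)) ⟩
  betaH h (suc d) 1 + betaH h d 0            ∎
  where
  open ≡-Reasoning
  ring : ∀ n x y → y - n * x ≡ (y - (+ 1 + n) * x) + x
  ring = solve-∀
betaH-pascal h {suc d} {suc k} (s≤s k≤d) = begin
  betaH h (suc d) (suc (suc k))
    ≡⟨ betaH-suc h d (suc k) ⟩
  -1ℤ * s * + Y * h₀ + betaH h′ d (suc k)
    ≡⟨ cong (λ q → -1ℤ * s * + Y * h₀ + q) (betaH-pascal h′ k≤d) ⟩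
  -1ℤ * s * + Y * h₀ + (P + Q)
    ≡⟨ ring s (+ X) (+ Y) h₀ P Q ⟩
  (-1ℤ * s * (+ X + + Y) * h₀ + P) + (s * + X * h₀ + Q)
    ≡⟨ cong (λ n → (-1ℤ * s * n * h₀ + P) + (s * + X * h₀ + Q)) X+Y ⟩
  (-1ℤ * s * + (suc (suc d) C suc (suc k)) * h₀ + P) + (s * + X * h₀ + Q)
    ≡⟨ sym (cong₂ _+_ (betaH-suc h (suc d) (suc k)) (betaH-suc h d k)) ⟩
  betaH h (suc (suc d)) (suc (suc k)) + betaH h (suc d) (suc k)
    ∎
  where
  open ≡-Reasoning
  h′ = h ∘ suc
  h₀ = + h 0
  s = -1ℤ ^ suc k
  X = suc d C suc k
  Y = suc d C suc (suc k)
  P = betaH h′ (suc d) (suc k)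
  Q = betaH h′ d k
  X+Y : + X + + Y ≡ + (suc (suc d) C suc (suc k))
  X+Y = trans (sym (ℤP.pos-+ X Y)) (cong +_ (nCk+nC[k+1]≡[n+1]C[k+1] (suc d) (suc k)))
  ring : ∀ s x y h p q → -1ℤ * s * y * h + (p + q) ≡
                        (-1ℤ * s * (x + y) * h + p) + (s * x * h + q)
  ring = solve-∀

DepthOK-pred : ∀ {h d} → DepthOK h (suc d) → DepthOK h d
DepthOK-pred {h} {d} ok zero    _   = subst (0ℤ ≤_) (sym (betaH-zero h d)) (+≤+ z≤n)
DepthOK-pred {h} {d} ok (suc k) k<d = subst (0ℤ ≤_) (sym (betaH-pascal h (ℕP.<⇒≤ k<d)))
  (ℤP.+-mono-≤ (ok (suc k) (ℕP.m≤n⇒m≤1+n k<d)) (DepthOK-pred ok k (ℕP.<⇒≤ k<d)))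

DepthOK-antitone : ∀ {h m n} → m ℕ.≤ n → DepthOK h n → DepthOK h m
DepthOK-antitone m≤n = go (ℕP.≤⇒≤′ m≤n)
  where
  go : ∀ {h m n} → m ≤′ n → DepthOK h n → DepthOK h m
  go (≤′-reflexive refl) ok = ok
  go (≤′-step m≤′n)      ok = go m≤′n (DepthOK-pred ok)

betaH-two : ∀ h m → betaH h (suc m) 2 ≡ + (suc m C 2) * + h 0 - + m * + h 1 + + h 2
betaH-two h m = trans (betaH-suc h m 1)
  (trans (cong (λ q → 1ℤ * + (suc m C 2) * + h 0 + q) (betaH-one (h ∘ suc) m))
         (ring (+ (suc m C 2)) (+ m) (+ h 0) (+ h 1) (+ h 2)))
  where
  ring : ∀ c m x y z → 1ℤ * c * x + (z - m * y) ≡ c * x - m * y + z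
  ring = solve-∀

2*[1+m]C2≡[1+m]*m : ∀ m → 2 ℕ.* (suc m C 2) ≡ suc m ℕ.* m
2*[1+m]C2≡[1+m]*m zero    = refl
2*[1+m]C2≡[1+m]*m (suc m) = begin
  2 ℕ.* (suc (suc m) C 2)              ≡⟨ cong (2 ℕ.*_) (sym (nCk+nC[k+1]≡[n+1]C[k+1] (suc m) 1)) ⟩
  2 ℕ.* (suc m C 1 ℕ.+ suc m C 2)      ≡⟨ cong (λ n → 2 ℕ.* (n ℕ.+ suc m C 2)) (nC1≡n (suc m)) ⟩
  2 ℕ.* (suc m ℕ.+ suc m C 2)          ≡⟨ ℕP.*-distribˡ-+ 2 (suc m) (suc m C 2) ⟩
  2 ℕ.* suc m ℕ.+ 2 ℕ.* (suc m C 2)    ≡⟨ cong (2 ℕ.* suc m ℕ.+_) (2*[1+m]C2≡[1+m]*m m) ⟩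
  2 ℕ.* suc m ℕ.+ suc m ℕ.* m          ≡⟨ ring m ⟩
  suc (suc m) ℕ.* suc m                ∎
  where
  open ≡-Reasoning
  open import Data.Nat.Tactic.RingSolver using () renaming (solve-∀ to solveℕ-∀)
  ring : ∀ m → 2 ℕ.* suc m ℕ.+ suc m ℕ.* m ≡ suc (suc m) ℕ.* suc m
  ring = solveℕ-∀

twice-betaH-two : ∀ h m →
  + 2 * betaH h (suc m) 2 ≡ + suc m * + m * + h 0 - + 2 * + m * + h 1 + + 2 * + h 2
twice-betaH-two h m = begin
  + 2 * betaH h (suc m) 2
    ≡⟨ cong (+ 2 *_) (betaH-two h m) ⟩
  + 2 * (+ c * + h 0 - + m * + h 1 + + h 2)
    ≡⟨ ring (+ c) (+ m) (+ h 0) (+ h 1) (+ h 2) ⟩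
  + 2 * + c * + h 0 - + 2 * + m * + h 1 + + 2 * + h 2
    ≡⟨ cong (λ n → n * + h 0 - + 2 * + m * + h 1 + + 2 * + h 2) 2c≡[1+m]m ⟩
  + suc m * + m * + h 0 - + 2 * + m * + h 1 + + 2 * + h 2
    ∎
  where
  open ≡-Reasoning
  c = suc m C 2
  2c≡[1+m]m : + 2 * + c ≡ + suc m * + m
  2c≡[1+m]m = trans (sym (ℤP.pos-* 2 c)) (trans (cong +_ (2*[1+m]C2≡[1+m]*m m)) (ℤP.pos-* (suc m) m))
  ring : ∀ c m x y z → + 2 * (c * x - m * y + z) ≡ + 2 * c * x - + 2 * m * y + + 2 * z
  ring = solve-∀

cubic : ℤ → ℤ → ℤ → ℤ → ℕ → ℤ
cubic a b c e j = a * (+ j) ^ 3 + b * (+ j) ^ 2 + c * (+ j) + e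

-- Integer expressions, evaluated both in ℤ and in ℚ, to carry identities across fromℤ.
infixl 6 _:+_ _:-_
infixl 7 _:*_

data Expr : Set where
  con       : ℤ → Expr
  _:+_ _:*_ : Expr → Expr → Expr
  :-_       : Expr → Expr

_:-_ : Expr → Expr → Expr
p :- q = p :+ (:- q)

evalℤ : Expr → ℤ
evalℤ (con z)  = z
evalℤ (p :+ q) = evalℤ p + evalℤ q
evalℤ (p :* q) = evalℤ p * evalℤ q
evalℤ (:- p)   = - evalℤ p

-- 2e · f(x), with the denominators of α = a/e, β = b/e, γ = c/e cleared.
clearedF : ℤ → ℤ → ℤ → ℤ → ℤ → Expr
clearedF a b c e x =
  con e :* con x :* con x
  :- (con (+ 2) :* (con a :+ con b :+ con c) :+ con (+ 3) :* con e) :* con x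
  :+ (con (+ 18) :* con a :+ con (+ 10) :* con b :+ con (+ 6) :* con c :+ con (+ 4) :* con e)

twice-betaH-two-cubic : ∀ a b c e h → (∀ j → + h j ≡ cubic a b c e j) →
  ∀ m → + 2 * betaH h (suc m) 2 ≡ evalℤ (clearedF a b c e (+ suc m))
twice-betaH-two-cubic a b c e h h≡cubic m = begin
  + 2 * betaH h (suc m) 2
    ≡⟨ twice-betaH-two h m ⟩
  D (+ h 0) (+ h 1) (+ h 2)
    ≡⟨ cong₂ (λ x y → D x y (+ h 2)) (h≡cubic 0) (h≡cubic 1) ⟩
  D (cubic a b c e 0) (cubic a b c e 1) (+ h 2)
    ≡⟨ cong (D (cubic a b c e 0) (cubic a b c e 1)) (h≡cubic 2) ⟩
  D (cubic a b c e 0) (cubic a b c e 1) (cubic a b c e 2)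
    ≡⟨ ring a b c e (+ m) ⟩
  evalℤ (clearedF a b c e (+ suc m))
    ∎
  where
  open ≡-Reasoning
  D : ℤ → ℤ → ℤ → ℤ
  D x y z = + suc m * + m * x - + 2 * + m * y + + 2 * z
  ring : ∀ a b c e m →
    (+ 1 + m) * m * (a * + 0 + b * + 0 + c * + 0 + e) - + 2 * m * (a * + 1 + b * + 1 + c * + 1 + e)
      + + 2 * (a * + 8 + b * + 4 + c * + 2 + e)
    ≡ e * (+ 1 + m) * (+ 1 + m) - (+ 2 * (a + b + c) + + 3 * e) * (+ 1 + m)
      + (+ 18 * a + + 10 * b + + 6 * c + + 4 * e)
  ring = solve-∀

fromℤ : ℤ → ℚ
fromℤ z = z ℚ./ 1

toℚᵘ-fromℤ : ∀ z → ℚ.toℚᵘ (fromℤ z) ℚᵘ.≃ mkℚᵘ z 0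
toℚᵘ-fromℤ z = ℚP.toℚᵘ-fromℚᵘ (mkℚᵘ z 0)

module _ where
  open ℚᵘP.≃-Reasoning

  fromℤ-+ : ∀ x y → fromℤ (x + y) ≡ fromℤ x ℚ.+ fromℤ y
  fromℤ-+ x y = ℚP.toℚᵘ-injective (begin
    ℚ.toℚᵘ (fromℤ (x + y))                     ≈⟨ toℚᵘ-fromℤ (x + y) ⟩
    mkℚᵘ (x + y) 0                              ≈⟨ *≡* (ring x y) ⟩
    mkℚᵘ x 0 ℚᵘ.+ mkℚᵘ y 0                      ≈⟨ ℚᵘP.+-cong (toℚᵘ-fromℤ x) (toℚᵘ-fromℤ y) ⟨
    ℚ.toℚᵘ (fromℤ x) ℚᵘ.+ ℚ.toℚᵘ (fromℤ y)     ≈⟨ ℚP.toℚᵘ-homo-+ (fromℤ x) (fromℤ y) ⟨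
    ℚ.toℚᵘ (fromℤ x ℚ.+ fromℤ y)               ∎)
    where
    ring : ∀ x y → (x + y) * + 1 ≡ (x * + 1 + y * + 1) * + 1
    ring = solve-∀

  fromℤ-* : ∀ x y → fromℤ (x * y) ≡ fromℤ x ℚ.* fromℤ y
  fromℤ-* x y = ℚP.toℚᵘ-injective (begin
    ℚ.toℚᵘ (fromℤ (x * y))                     ≈⟨ toℚᵘ-fromℤ (x * y) ⟩
    mkℚᵘ x 0 ℚᵘ.* mkℚᵘ y 0                      ≈⟨ ℚᵘP.*-cong (toℚᵘ-fromℤ x) (toℚᵘ-fromℤ y) ⟨
    ℚ.toℚᵘ (fromℤ x) ℚᵘ.* ℚ.toℚᵘ (fromℤ y)     ≈⟨ ℚP.toℚᵘ-homo-* (fromℤ x) (fromℤ y) ⟨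
    ℚ.toℚᵘ (fromℤ x ℚ.* fromℤ y)               ∎)

  fromℤ-neg : ∀ x → fromℤ (- x) ≡ ℚ.- fromℤ x
  fromℤ-neg x = ℚP.toℚᵘ-injective (begin
    ℚ.toℚᵘ (fromℤ (- x))                       ≈⟨ toℚᵘ-fromℤ (- x) ⟩
    ℚᵘ.- mkℚᵘ x 0                               ≈⟨ ℚᵘP.-‿cong (toℚᵘ-fromℤ x) ⟨
    ℚᵘ.- ℚ.toℚᵘ (fromℤ x)                      ≈⟨ ℚP.toℚᵘ-homo‿- (fromℤ x) ⟨
    ℚ.toℚᵘ (ℚ.- fromℤ x)                       ∎)

  z/n*n≡z : ∀ z n .{{_ : NonZero n}} → z ℚ./ n ℚ.* fromℤ (+ n) ≡ fromℤ z
  z/n*n≡z z n@(suc n-1) = ℚP.toℚᵘ-injective (begin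
    ℚ.toℚᵘ (z ℚ./ n ℚ.* fromℤ (+ n))           ≈⟨ ℚP.toℚᵘ-homo-* (z ℚ./ n) (fromℤ (+ n)) ⟩
    ℚ.toℚᵘ (z ℚ./ n) ℚᵘ.* ℚ.toℚᵘ (fromℤ (+ n))
      ≈⟨ ℚᵘP.*-cong (ℚP.toℚᵘ-fromℚᵘ (mkℚᵘ z n-1)) (toℚᵘ-fromℤ (+ n)) ⟩
    mkℚᵘ z n-1 ℚᵘ.* mkℚᵘ (+ n) 0                ≈⟨ *≡* cross ⟩
    mkℚᵘ z 0                                    ≈⟨ toℚᵘ-fromℤ z ⟨
    ℚ.toℚᵘ (fromℤ z)                           ∎)
    where
    cross : z * + n * + 1 ≡ z * + (n ℕ.* 1)
    cross = trans (ℤP.*-identityʳ (z * + n)) (cong (λ m → z * + m) (sym (ℕP.*-identityʳ n)))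

fromℤ-nonNeg : ∀ {z} → 0ℤ ≤ z → ℚ.0ℚ ℚ.≤ fromℤ z
fromℤ-nonNeg {+ n} _ = ℚP.nonNegative⁻¹ (fromℤ (+ n)) {{ℚP.normalize-nonNeg n 1}}

evalℚ : Expr → ℚ
evalℚ (con z)  = fromℤ z
evalℚ (p :+ q) = evalℚ p ℚ.+ evalℚ q
evalℚ (p :* q) = evalℚ p ℚ.* evalℚ q
evalℚ (:- p)   = ℚ.- evalℚ p

fromℤ-evalℤ : ∀ p → fromℤ (evalℤ p) ≡ evalℚ p
fromℤ-evalℤ (con z)  = refl
fromℤ-evalℤ (p :+ q) = trans (fromℤ-+ (evalℤ p) (evalℤ q)) (cong₂ ℚ._+_ (fromℤ-evalℤ p) (fromℤ-evalℤ q))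
fromℤ-evalℤ (p :* q) = trans (fromℤ-* (evalℤ p) (evalℤ q)) (cong₂ ℚ._*_ (fromℤ-evalℤ p) (fromℤ-evalℤ q))
fromℤ-evalℤ (:- p)   = trans (fromℤ-neg (evalℤ p)) (cong ℚ.-_ (fromℤ-evalℤ p))

ℚ-ring : ACR.AlmostCommutativeRing 0ℓ 0ℓ
ℚ-ring = ACR.fromCommutativeRing ℚP.+-*-commutativeRing (λ q → dec⇒maybe (ℚ.0ℚ ℚP.≟ q))

twice-e-fPoly : ∀ a b c e .{{_ : NonZero e}} x →
  fromℤ (+ 2) ℚ.* fromℤ (+ e) ℚ.* fPoly a b c e (fromℤ x) ≡ evalℚ (clearedF a b c (+ e) x)
twice-e-fPoly a b c e x = clear (a ℚ./ e) (b ℚ./ e) (c ℚ./ e) (fromℤ (+ e)) (fromℤ x)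
  (z/n*n≡z a e) (z/n*n≡z b e) (z/n*n≡z c e)
  where
  clear : ∀ α β γ E D {A B C} → α ℚ.* E ≡ A → β ℚ.* E ≡ B → γ ℚ.* E ≡ C →
    fromℤ (+ 2) ℚ.* E ℚ.* (½ ℚ.* D ℚ.* D ℚ.- (α ℚ.+ β ℚ.+ γ ℚ.+ (+ 3 ℚ./ 2)) ℚ.* D
      ℚ.+ (fromℤ (+ 9) ℚ.* α ℚ.+ fromℤ (+ 5) ℚ.* β ℚ.+ fromℤ (+ 3) ℚ.* γ ℚ.+ fromℤ (+ 2)))
    ≡ E ℚ.* D ℚ.* D ℚ.- (fromℤ (+ 2) ℚ.* (A ℚ.+ B ℚ.+ C) ℚ.+ fromℤ (+ 3) ℚ.* E) ℚ.* D
      ℚ.+ (fromℤ (+ 18) ℚ.* A ℚ.+ fromℤ (+ 10) ℚ.* B ℚ.+ fromℤ (+ 6) ℚ.* C ℚ.+ fromℤ (+ 4) ℚ.* E)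
  clear α β γ E D refl refl refl = RingSolver.solve (α ∷ β ∷ γ ∷ E ∷ D ∷ []) ℚ-ring

betaH-two-nonNeg⇒fPoly-nonNeg : ∀ a b c e .{{_ : NonZero e}} h →
  (∀ j → + h j ≡ cubic a b c (+ e) j) →
  ∀ m → 0ℤ ≤ betaH h (suc m) 2 → ℚ.0ℚ ℚ.≤ fPoly a b c e (fromℤ (+ suc m))
betaH-two-nonNeg⇒fPoly-nonNeg a b c e h h≡cubic m 0≤β =
  ℚP.*-cancelˡ-≤-pos r (subst (ℚ._≤ r ℚ.* f) (sym (ℚP.*-zeroʳ r)) 0≤rf)
  where
  r = fromℤ (+ 2) ℚ.* fromℤ (+ e)
  f = fPoly a b c e (fromℤ (+ suc m))
  instance
    r-pos : ℚ.Positive r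
    r-pos = ℚP.pos*pos⇒pos (fromℤ (+ 2)) {{ℚP.normalize-pos 2 1}}
                           (fromℤ (+ e)) {{ℚP.normalize-pos e 1}}
  2β≡rf : fromℤ (+ 2 * betaH h (suc m) 2) ≡ r ℚ.* f
  2β≡rf = trans (cong fromℤ (twice-betaH-two-cubic a b c (+ e) h h≡cubic m))
         (trans (fromℤ-evalℤ (clearedF a b c (+ e) (+ suc m))) (sym (twice-e-fPoly a b c e (+ suc m))))
  0≤rf : ℚ.0ℚ ℚ.≤ r ℚ.* f
  0≤rf = subst (ℚ.0ℚ ℚ.≤_) 2β≡rf (fromℤ-nonNeg (ℤP.*-monoˡ-≤-nonNeg (+ 2) 0≤β))

lemma3p2 : (a b c : ℤ) (e : ℕ) .{{_ : NonZero e}} → a ≢ 0ℤ →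
    (h : ℕ → ℕ) →
    (∀ j → + h j ≡ a ℤ.* (+ j) ℤ.^ 3 ℤ.+ b ℤ.* (+ j) ℤ.^ 2 ℤ.+ c ℤ.* (+ j) ℤ.+ + e) →
    (+ 2 ℚ./ 1) ℚ.≤ (a ℚ./ e) ℚ.+ (b ℚ./ e) ℚ.+ (c ℚ./ e) →
    (d : ℕ) → 3 ℕ.≤ d → d ℕ.≤ cH h ℕ.+ 1 →
    fPoly a b c e (+ d ℚ./ 1) ℚ.< ℚ.0ℚ →
    ∀ n → IsHDepth h n → n ℕ.< d
lemma3p2 a b c e _ h h≡cubic _ (suc m) 3≤d _ f<0 n (depth-n , _) =
  ℕP.≰⇒> λ d≤n → ℚP.<-irrefl refl (ℚP.<-≤-trans f<0
    (betaH-two-nonNeg⇒fPoly-nonNeg a b c e h h≡cubic m (DepthOK-antitone d≤n depth-n 2 2≤d)))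
  where
  2≤d : 2 ℕ.≤ suc m
  2≤d = ℕP.≤-trans (ℕP.n≤1+n 2) 3≤d
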